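{- Let $X$ be a totally ordered set, let $k\ge4$ be a power of $2$, let $\bar{b}=\langle b_1,\dots,b_k\rangle\in X^k$ be v-shape s-dominating, and let $\bar{w}=half\_split^k(\bar{b})$. Then (1) $\bar{w}_{\mathit{left}}=\langle w_1,\dots,w_{k/2}\rangle$ is v-shape s-dominating; (2) $\bar{w}_{\mathit{right}}=\langle w_{k/2+1},\dots,w_k\rangle$ is bitonic; (3) $\bar{w}_{\mathit{left}}\succeq\bar{w}_{\mathit{right}}$.
   Context: A comparator on positions $i<j$ replaces $(x_i,x_j)$ by $(\max(x_i,x_j),\min(x_i,x_j))$. The half-splitter $half\_split^k$ applies comparators to positions $(k/4+j,\,3k/4+j)$ for $j=1,\dots,k/4$ (all other positions unchanged). A sequence $\bar b$ of length $k$ is v-shaped if $b_1\ge\dots\ge b_i\le\dots\le b_k$ for some $i$; s-dominating if $b_j\ge b_{k-j+1}$ for $1\le j\le k/2$ (for a sequence of length $k/2$, with $k/2$ in place of $k$); v-shape s-dominating if both. A sequence is bitonic if it has the form $x_1\le\dots\le x_i\ge\dots\ge x_n$ or is a circular shift of such. $\bar{a}\succeq\bar{c}$ means every element of $\bar a$ is $\ge$ every element of $\bar c$. -}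

module Defs where

open import Level using (Level)
open import Data.Nat as ℕ using (ℕ; zero; suc; _+_; _*_; _∸_; _/_; _<_; _≤_; _<?_; _≤?_)
open import Data.Nat.Properties as ℕP
open import Data.Nat.DivMod using (m/n*n≤m)
open import Data.Fin as Fin using (Fin; toℕ; fromℕ<; opposite)
open import Data.Fin.Properties using (toℕ<n)
open import Data.Product using (Σ; ∃; _×_; _,_)
open import Data.Sum using (_⊎_; inj₁; inj₂)
open import Relation.Nullary using (yes; no)
open import Relation.Binary.Bundles using (TotalOrder)
open import Relation.Binary.PropositionalEquality using (_≡_; refl)

-- Sequences of length n over a carrier X are functions Fin n → X
-- (0-based indices: position p (1-based) of the paper is index p-1 here).

private
  half≤ : ∀ k → k / 2 + k / 2 ≤ k
  half≤ k = ≤-trans (≤-reflexive (trans' k)) (m/n*n≤m k 2)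
    where
    trans' : ∀ k → k / 2 + k / 2 ≡ k / 2 * 2
    trans' k rewrite *-comm (k / 2) 2 | +-identityʳ (k / 2) = refl

  sub<  : ∀ {n a b} → a < n → b < n → a + b ∸ n < n
  sub< {n} {a} {b} a<n b<n =
    ≤-<-trans (≤-trans (∸-monoˡ-≤ n (+-monoʳ-≤ a (<⇒≤ b<n)))
                       (≤-reflexive (m+n∸n≡m a n))) a<n

leftHalf : ∀ {a} {X : Set a} {k} → (Fin k → X) → Fin (k / 2) → X
leftHalf {k = k} w j =
  w (fromℕ< (<-≤-trans (toℕ<n j) (≤-trans (m≤m+n (k / 2) (k / 2)) (half≤ k))))

rightHalf : ∀ {a} {X : Set a} {k} → (Fin k → X) → Fin (k / 2) → X
rightHalf {k = k} w j =
  w (fromℕ< {k / 2 + toℕ j} (<-≤-trans (+-monoʳ-< (k / 2) (toℕ<n j)) (half≤ k)))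

rotate : ∀ {a} {X : Set a} {n} → Fin n → (Fin n → X) → Fin n → X
rotate {n = n} s x j with toℕ j + toℕ s <? n
... | yes p = x (fromℕ< p)
... | no  _ = x (fromℕ< (sub< {n} (toℕ<n j) (toℕ<n s)))

module _ {c ℓ₁ ℓ₂ : Level} (O : TotalOrder c ℓ₁ ℓ₂) where
  open TotalOrder O renaming (Carrier to X; _≤_ to _⊑_)

  max : X → X → X
  max x y with total x y
  ... | inj₁ _ = y
  ... | inj₂ _ = x

  min : X → X → X
  min x y with total x y
  ... | inj₁ _ = x
  ... | inj₂ _ = y

  -- half_split^k : comparators on positions (k/4+j, 3k/4+j), j = 1..k/4 (1-based),
  -- i.e. 0-based indices t ∈ [k/4, k/2) paired with t + k/2; the lower index gets
  -- the max, the higher index the min.  All other positions unchanged.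
  halfSplit : ∀ {k} → (Fin k → X) → Fin k → X
  halfSplit {k} b i with k / 4 ≤? toℕ i | toℕ i <? k / 2 | 3 * (k / 4) ≤? toℕ i
  ... | yes _ | yes _ | _ with toℕ i + k / 2 <? k
  ...   | yes p = max (b i) (b (fromℕ< p))
  ...   | no  _ = b i
  halfSplit {k} b i | _ | _ | yes q with k / 2 ≤? toℕ i
  ...   | yes r = min (b (fromℕ< {toℕ i ∸ k / 2}
                            (≤-<-trans (m∸n≤m (toℕ i) (k / 2)) (toℕ<n i)))) (b i)
  ...   | no  _ = b i
  halfSplit {k} b i | _ | _ | no _ = b i

  VShaped : ∀ {n} → (Fin n → X) → Set ℓ₂
  VShaped {n} b = ∃ λ (i : Fin n) →
    (∀ (j j' : Fin n) → toℕ j ≤ toℕ j' → toℕ j' ≤ toℕ i → b j' ⊑ b j) ×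
    (∀ (j j' : Fin n) → toℕ i ≤ toℕ j → toℕ j ≤ toℕ j' → b j ⊑ b j')

  -- s-dominating: b_j ≥ b_{n-j+1} for 1 ≤ j ≤ n/2  (0-based: index j vs n-1-j)
  SDominating : ∀ {n} → (Fin n → X) → Set ℓ₂
  SDominating {n} b = ∀ (j : Fin n) → toℕ j < n / 2 → b (opposite j) ⊑ b j

  VShapeSDominating : ∀ {n} → (Fin n → X) → Set ℓ₂
  VShapeSDominating b = VShaped b × SDominating b

  Unimodal : ∀ {n} → (Fin n → X) → Set ℓ₂
  Unimodal {n} x = ∃ λ (i : Fin n) →
    (∀ (j j' : Fin n) → toℕ j ≤ toℕ j' → toℕ j' ≤ toℕ i → x j ⊑ x j') ×
    (∀ (j j' : Fin n) → toℕ i ≤ toℕ j → toℕ j ≤ toℕ j' → x j' ⊑ x j)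

  Bitonic : ∀ {n} → (Fin n → X) → Set ℓ₂
  Bitonic {n} x = ∃ λ (s : Fin n) → Unimodal (rotate s x)

  _⪰_ : ∀ {m n} → (Fin m → X) → (Fin n → X) → Set ℓ₂
  a ⪰ c' = ∀ i j → c' j ⊑ a i

-- The comparators that half_split omits are redundant. For y < k/4 the position y + k/2 lies
-- between y and its mirror image k-1-y; a v-shaped sequence is bounded on an interval by its two
-- ends, and s-domination bounds the far end by b_y, so b_{y+k/2} ≤ b_y. Hence the left half is the
-- pointwise max and the right half the pointwise min of the pairs (b_y, b_{y+k/2}).
-- V-shaped means quasiconvex (b_j ≤ max b_i b_l for i ≤ j ≤ l), a property preserved by pointwise
-- max, and the same mirror argument shows the maxima are s-dominating. The pointwise min admits
-- no pattern high, low, high, low at four positions; rotating a minimum to the front then leaves a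
-- quasiconcave, i.e. unimodal, sequence, so it is bitonic. Finally each min is below each max,
-- since one entry of the min's pair lies between the two positions of the max's pair.
module Submission where

open import Defs
open import Level using (Level)
open import Algebra.Construct.NaturalChoice.Base using (MinOperator; MaxOperator)
import Algebra.Construct.NaturalChoice.MinMaxOp as MinMaxOp
open import Data.Fin using (Fin; toℕ; fromℕ<; opposite)
open import Data.Fin.Properties using (toℕ<n; toℕ-fromℕ<; fromℕ<-toℕ; opposite-prop)
open import Data.List.Base using (allFin)
import Data.List.Extrema as Extrema
open import Data.List.Membership.Propositional.Properties using (∈-allFin)
open import Data.List.Relation.Unary.All using (lookup)
open import Data.Nat using (ℕ; suc; _+_; _*_; _∸_; _/_; _^_; _<_; _≤_; _<?_; _≤?_; s≤s; z<s; z≤n)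
open import Data.Nat.DivMod using (m*n/n≡m; m≥n⇒m/n>0)
open import Data.Nat.Divisibility using (_∣_; divides)
open import Data.Nat.Properties
  using (≤-reflexive; ≤-trans; <-trans; ≤-<-trans; <-≤-trans; <⇒≤; ≰⇒>; ≮⇒≥; <⇒≱; ≤⇒≯;
         m≤m+n; m≤n+m; +-comm; +-assoc; +-identityʳ; *-comm;
         +-mono-≤; +-monoˡ-≤; +-monoʳ-≤; +-mono-<; +-monoˡ-<; +-monoʳ-<;
         m∸n≤m; ∸-monoˡ-≤; ∸-monoʳ-≤; ∸-monoˡ-<; ∸-monoʳ-<;
         m+n∸m≡n; m+n∸n≡m; m∸n+n≡m; m+[n∸m]≡n; m+n≤o⇒m≤o∸n)
open import Data.Nat.Solver using (module +-*-Solver)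
open import Data.Product using (∃; _×_; _,_; proj₁; proj₂)
open import Data.Sum using (inj₁; inj₂)
open import Relation.Binary.Bundles using (TotalOrder)
open import Relation.Binary.PropositionalEquality using (_≡_; refl; sym; trans; cong; cong₂; subst)
open import Relation.Nullary using (Dec; yes; no; ¬_)
open import Relation.Nullary.Negation using (contradiction)

open +-*-Solver using (solve; _:=_; _:+_; _:*_; con)

data ToℕView (n : ℕ) : ℕ → Set where
  toℕ-of : (i : Fin n) → ToℕView n (toℕ i)

toℕ-view : ∀ {n i} → i < n → ToℕView n i
toℕ-view {n} i<n = subst (ToℕView n) (toℕ-fromℕ< i<n) (toℕ-of (fromℕ< i<n))

[m+m]/2≡m : ∀ m → (m + m) / 2 ≡ m
[m+m]/2≡m m = trans (cong (_/ 2) (trans (cong (m +_) (sym (+-identityʳ m))) (*-comm 2 m))) (m*n/n≡m m 2)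

4∣⇒exact-halving : ∀ {k} → 4 ∣ k → k / 2 + k / 2 ≡ k × k / 4 + k / 4 ≡ k / 2
4∣⇒exact-halving (divides m refl) = trans (cong₂ _+_ k/2 k/2) (sym k≡) , trans (cong₂ _+_ k/4 k/4) (sym k/2)
  where
  k≡ : m * 4 ≡ (m + m) + (m + m)
  k≡ = solve 1 (λ x → x :* con 4 := (x :+ x) :+ (x :+ x)) refl m
  k/2 : m * 4 / 2 ≡ m + m
  k/2 = trans (cong (_/ 2) k≡) ([m+m]/2≡m (m + m))
  k/4 : m * 4 / 4 ≡ m
  k/4 = m*n/n≡m m 4

4≤2^p⇒4∣2^p : ∀ p → 4 ≤ 2 ^ p → 4 ∣ 2 ^ p
4≤2^p⇒4∣2^p 0 (s≤s ())
4≤2^p⇒4∣2^p 1 (s≤s (s≤s ()))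
4≤2^p⇒4∣2^p (suc (suc r)) _ =
  divides (2 ^ r) (solve 1 (λ x → con 2 :* (con 2 :* x) := x :* con 4) refl (2 ^ r))

module _ {c ℓ₁ ℓ₂ : Level} (O : TotalOrder c ℓ₁ ℓ₂) where

  open TotalOrder O using (_≈_; antisym; total; totalPreorder; module Eq)
    renaming (Carrier to X; _≤_ to _⊑_; refl to ⊑-refl; trans to ⊑-trans;
              ≤-respˡ-≈ to ⊑-respˡ-≈; ≤-respʳ-≈ to ⊑-respʳ-≈)

  minOperator : MinOperator totalPreorder
  minOperator = record { _⊓_ = min O ; x≤y⇒x⊓y≈x = x⊑y⇒min≈x ; x≥y⇒x⊓y≈y = y⊑x⇒min≈y }
    where
    x⊑y⇒min≈x : ∀ {x y} → x ⊑ y → min O x y ≈ x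
    x⊑y⇒min≈x {x} {y} x⊑y with total x y
    ... | inj₁ _   = Eq.refl
    ... | inj₂ y⊑x = antisym y⊑x x⊑y
    y⊑x⇒min≈y : ∀ {x y} → y ⊑ x → min O x y ≈ y
    y⊑x⇒min≈y {x} {y} y⊑x with total x y
    ... | inj₁ x⊑y = antisym x⊑y y⊑x
    ... | inj₂ _   = Eq.refl

  maxOperator : MaxOperator totalPreorder
  maxOperator = record { _⊔_ = max O ; x≤y⇒x⊔y≈y = x⊑y⇒max≈y ; x≥y⇒x⊔y≈x = y⊑x⇒max≈x }
    where
    x⊑y⇒max≈y : ∀ {x y} → x ⊑ y → max O x y ≈ y
    x⊑y⇒max≈y {x} {y} x⊑y with total x y
    ... | inj₁ _   = Eq.refl
    ... | inj₂ y⊑x = antisym x⊑y y⊑x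
    y⊑x⇒max≈x : ∀ {x y} → y ⊑ x → max O x y ≈ x
    y⊑x⇒max≈x {x} {y} y⊑x with total x y
    ... | inj₁ x⊑y = antisym y⊑x x⊑y
    ... | inj₂ _   = Eq.refl

  open MinOperator minOperator using (_⊓_; x≥y⇒x⊓y≈y)
  open MaxOperator maxOperator using (_⊔_; x≥y⇒x⊔y≈x; x≤y⇒x⊔y≈y)
  open MinMaxOp minOperator maxOperator

  ⊑-resp-≈ : ∀ {x x′ y y′} → x ≈ x′ → y ≈ y′ → x ⊑ y → x′ ⊑ y′
  ⊑-resp-≈ x≈x′ y≈y′ x⊑y = ⊑-respˡ-≈ x≈x′ (⊑-respʳ-≈ y≈y′ x⊑y)

  -- The junk value d is only read outside [0, n).
  extend : ∀ {n} → X → (Fin n → X) → ℕ → X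
  extend {n} d f i with i <? n
  ... | yes i<n = f (fromℕ< i<n)
  ... | no  _   = d

  extend-fromℕ< : ∀ {n} d (f : Fin n → X) {i} (i<n : i < n) → extend d f i ≡ f (fromℕ< i<n)
  extend-fromℕ< {n} d f {i} i<n with i <? n
  ... | yes _   = refl
  ... | no  i≮n = contradiction i<n i≮n

  extend-toℕ : ∀ {n} d (f : Fin n → X) i → extend d f (toℕ i) ≡ f i
  extend-toℕ d f i = trans (extend-fromℕ< d f (toℕ<n i)) (cong f (fromℕ<-toℕ i (toℕ<n i)))

  _≈[toℕ]_ : ∀ {n} → (Fin n → X) → (ℕ → X) → Set ℓ₁
  f ≈[toℕ] g = ∀ i → f i ≈ g (toℕ i)

  QuasiConvex : ℕ → (ℕ → X) → Set ℓ₂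
  QuasiConvex n g = ∀ {i j l} → i ≤ j → j ≤ l → l < n → g j ⊑ g i ⊔ g l

  QuasiConcave : ℕ → (ℕ → X) → Set ℓ₂
  QuasiConcave n g = ∀ {i j l} → i ≤ j → j ≤ l → l < n → g i ⊓ g l ⊑ g j

  AlternationFree : ℕ → (ℕ → X) → Set ℓ₂
  AlternationFree n g = ∀ {a b c d} → a ≤ b → b ≤ c → c ≤ d → d < n →
    g a ⊓ g c ⊑ g b ⊔ g d × g b ⊓ g d ⊑ g a ⊔ g c

  MirrorDominating : ℕ → (ℕ → X) → Set ℓ₂
  MirrorDominating m g = ∀ {i} → i < m → g (m + m ∸ suc i) ⊑ g i

  open Extrema O using (argmin; argmax; f[argmin]≤f[xs]; f[xs]≤f[argmax])

  argmin-minimal : ∀ {n} (f : Fin n → X) z j → f (argmin f z (allFin n)) ⊑ f j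
  argmin-minimal f z j = lookup (f[argmin]≤f[xs] z (allFin _)) (∈-allFin j)

  argmax-maximal : ∀ {n} (f : Fin n → X) z j → f j ⊑ f (argmax f z (allFin n))
  argmax-maximal f z j = lookup (f[xs]≤f[argmax] z (allFin _)) (∈-allFin j)

  vShaped⇒quasiConvex : ∀ {n} {f : Fin n → X} d → VShaped O f → QuasiConvex n (extend d f)
  vShaped⇒quasiConvex {f = f} d (v , down , up) i≤j j≤l l<n
    with toℕ-view (≤-<-trans i≤j (≤-<-trans j≤l l<n)) | toℕ-view (≤-<-trans j≤l l<n) | toℕ-view l<n
  ... | toℕ-of i | toℕ-of j | toℕ-of l
    rewrite extend-toℕ d f i | extend-toℕ d f j | extend-toℕ d f l with toℕ j ≤? toℕ v
  ...   | yes j≤v = ⊑-trans (down i j i≤j j≤v) (x≤x⊔y _ _)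
  ...   | no  j≰v = ⊑-trans (up j l (<⇒≤ (≰⇒> j≰v)) j≤l) (x≤y⊔x _ _)

  quasiConvex⇒vShaped : ∀ {n} {f : Fin n → X} {g} → f ≈[toℕ] g → QuasiConvex n g → Fin n → VShaped O f
  quasiConvex⇒vShaped {n} {f} f≈g qc z = v , down , up
    where
    v : Fin n
    v = argmin f z (allFin n)
    qcᶠ : ∀ i j l → toℕ i ≤ toℕ j → toℕ j ≤ toℕ l → f j ⊑ f i ⊔ f l
    qcᶠ i j l i≤j j≤l = ⊑-resp-≈ (Eq.sym (f≈g j)) (⊔-cong (Eq.sym (f≈g i)) (Eq.sym (f≈g l)))
                          (qc i≤j j≤l (toℕ<n l))
    down : ∀ j j′ → toℕ j ≤ toℕ j′ → toℕ j′ ≤ toℕ v → f j′ ⊑ f j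
    down j j′ j≤j′ j′≤v = ⊑-trans (qcᶠ j j′ v j≤j′ j′≤v) (⊔-lub ⊑-refl (argmin-minimal f z j))
    up : ∀ j j′ → toℕ v ≤ toℕ j → toℕ j ≤ toℕ j′ → f j ⊑ f j′
    up j j′ v≤j j≤j′ = ⊑-trans (qcᶠ v j j′ v≤j j≤j′) (⊔-lub (argmin-minimal f z j′) ⊑-refl)

  quasiConcave⇒unimodal : ∀ {n} {f : Fin n → X} {g} → f ≈[toℕ] g → QuasiConcave n g → Fin n → Unimodal O f
  quasiConcave⇒unimodal {n} {f} f≈g qc z = v , up , down
    where
    v : Fin n
    v = argmax f z (allFin n)
    qcᶠ : ∀ i j l → toℕ i ≤ toℕ j → toℕ j ≤ toℕ l → f i ⊓ f l ⊑ f j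
    qcᶠ i j l i≤j j≤l = ⊑-resp-≈ (⊓-cong (Eq.sym (f≈g i)) (Eq.sym (f≈g l))) (Eq.sym (f≈g j))
                          (qc i≤j j≤l (toℕ<n l))
    up : ∀ j j′ → toℕ j ≤ toℕ j′ → toℕ j′ ≤ toℕ v → f j ⊑ f j′
    up j j′ j≤j′ j′≤v = ⊑-trans (⊓-glb ⊑-refl (argmax-maximal f z j)) (qcᶠ j j′ v j≤j′ j′≤v)
    down : ∀ j j′ → toℕ v ≤ toℕ j → toℕ j ≤ toℕ j′ → f j′ ⊑ f j
    down j j′ v≤j j≤j′ = ⊑-trans (⊓-glb (argmax-maximal f z j′) ⊑-refl) (qcᶠ v j j′ v≤j j≤j′)

  sDominating⇒mirrorDominating : ∀ {n} {f : Fin n → X} d → n / 2 + n / 2 ≡ n →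
                                 SDominating O f → MirrorDominating (n / 2) (extend d f)
  sDominating⇒mirrorDominating {n} {f} d halves sd i<n/2
    with toℕ-view (<-≤-trans i<n/2 (subst (n / 2 ≤_) halves (m≤m+n _ _)))
  ... | toℕ-of i rewrite halves | sym (opposite-prop i) | extend-toℕ d f i | extend-toℕ d f (opposite i) =
    sd i i<n/2

  mirrorDominating⇒sDominating : ∀ {n} {f : Fin n → X} {g} → f ≈[toℕ] g → n / 2 + n / 2 ≡ n →
                                 MirrorDominating (n / 2) g → SDominating O f
  mirrorDominating⇒sDominating {n} {f} {g} f≈g halves md i i<n/2 =
    ⊑-resp-≈ (Eq.sym (Eq.trans (f≈g (opposite i)) (Eq.reflexive (cong g mirror)))) (Eq.sym (f≈g i))
      (md i<n/2)
    where
    mirror : toℕ (opposite i) ≡ n / 2 + n / 2 ∸ suc (toℕ i)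
    mirror = trans (opposite-prop i) (cong (_∸ suc (toℕ i)) (sym halves))

  rotateℕ : ℕ → ℕ → (ℕ → X) → ℕ → X
  rotateℕ n s g j with j + s <? n
  ... | yes _ = g (j + s)
  ... | no  _ = g (j + s ∸ n)

  rotate≈[toℕ]rotateℕ : ∀ {n} {f : Fin n → X} {g} s → f ≈[toℕ] g → rotate s f ≈[toℕ] rotateℕ n (toℕ s) g
  rotate≈[toℕ]rotateℕ {n} {g = g} s f≈g t with toℕ t + toℕ s <? n
  ... | yes _ = Eq.trans (f≈g _) (Eq.reflexive (cong g (toℕ-fromℕ< _)))
  ... | no  _ = Eq.trans (f≈g _) (Eq.reflexive (cong g (toℕ-fromℕ< _)))

  module _ {n} {g : ℕ → X} {s} (af : AlternationFree n g) (s<n : s < n)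
           (s-min : ∀ {j} → j < n → g s ⊑ g j) where
    private
      wrap< : ∀ {x} → x < n → ¬ (x + s < n) → x + s ∸ n < s
      wrap< {x} x<n x′≮n = <-≤-trans (∸-monoˡ-< (+-monoˡ-< s x<n) (≮⇒≥ x′≮n)) (≤-reflexive (m+n∸m≡n n s))

      wrap<n : ∀ {x} → x < n → ¬ (x + s < n) → x + s ∸ n < n
      wrap<n x<n x′≮n = <-trans (wrap< x<n x′≮n) s<n

      toMiddle : ∀ {x j′} → j′ < n → x ⊑ g s ⊔ g j′ → x ⊑ g j′
      toMiddle j′<n = ⊑-respʳ-≈ (x≤y⇒x⊔y≈y (s-min j′<n))

    -- In each case s, i′, j′, l′ (the rotated positions) are in cyclic order, so alternation-freeness
    -- bounds min (g i′) (g l′) by g s ⊔ g j′, which is g j′ since g s is minimal.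
    rotateℕ-quasiConcave : QuasiConcave n (rotateℕ n s g)
    rotateℕ-quasiConcave {i} {j} {l} i≤j j≤l l<n with i + s <? n | j + s <? n | l + s <? n
    ... | yes _ | yes j′<n | yes l′<n =
      toMiddle j′<n (proj₂ (af (m≤n+m s i) (+-monoˡ-≤ s i≤j) (+-monoˡ-≤ s j≤l) l′<n))
    ... | yes _ | yes j′<n | no l′≮n =
      toMiddle j′<n (⊑-respˡ-≈ (⊓-comm _ _)
        (proj₁ (af (<⇒≤ (wrap< l<n l′≮n)) (m≤n+m s i) (+-monoˡ-≤ s i≤j) j′<n)))
    ... | yes i′<n | no j′≮n | no l′≮n =
      toMiddle (wrap<n (≤-<-trans j≤l l<n) j′≮n) (⊑-resp-≈ (⊓-comm _ _) (⊔-comm _ _)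
        (proj₂ (af (∸-monoˡ-≤ n (+-monoˡ-≤ s j≤l)) (<⇒≤ (wrap< l<n l′≮n)) (m≤n+m s i) i′<n)))
    ... | no i′≮n | no j′≮n | no l′≮n =
      toMiddle (wrap<n (≤-<-trans j≤l l<n) j′≮n) (⊑-respʳ-≈ (⊔-comm _ _)
        (proj₁ (af (∸-monoˡ-≤ n (+-monoˡ-≤ s i≤j)) (∸-monoˡ-≤ n (+-monoˡ-≤ s j≤l))
                   (<⇒≤ (wrap< l<n l′≮n)) s<n)))
    ... | no i′≮n | yes j′<n | _ = contradiction (≤-<-trans (+-monoˡ-≤ s i≤j) j′<n) i′≮n
    ... | _ | no j′≮n | yes l′<n = contradiction (≤-<-trans (+-monoˡ-≤ s j≤l) l′<n) j′≮n

  alternationFree⇒bitonic : ∀ {n} {f : Fin n → X} {g} → f ≈[toℕ] g → AlternationFree n g → Fin n → Bitonic O f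
  alternationFree⇒bitonic {n} {f} {g} f≈g af z =
    s , quasiConcave⇒unimodal (rotate≈[toℕ]rotateℕ s f≈g) (rotateℕ-quasiConcave af (toℕ<n s) s-min) z
    where
    s : Fin n
    s = argmin f z (allFin n)
    s-min : ∀ {j} → j < n → g (toℕ s) ⊑ g j
    s-min j<n with toℕ-view j<n
    ... | toℕ-of j = ⊑-resp-≈ (f≈g s) (f≈g j) (argmin-minimal f z j)

  maxHalf : ℕ → (ℕ → X) → ℕ → X
  maxHalf h b y = b y ⊔ b (y + h)

  minHalf : ℕ → (ℕ → X) → ℕ → X
  minHalf h b y = b y ⊓ b (y + h)

  quasiConvex-≤ : ∀ {m n g} → m ≤ n → QuasiConvex n g → QuasiConvex m g
  quasiConvex-≤ m≤n qc i≤j j≤l l<m = qc i≤j j≤l (<-≤-trans l<m m≤n)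

  quasiConvex-shift : ∀ {n g} h → QuasiConvex (n + h) g → QuasiConvex n (λ i → g (i + h))
  quasiConvex-shift h qc i≤j j≤l l<n = qc (+-monoˡ-≤ h i≤j) (+-monoˡ-≤ h j≤l) (+-monoˡ-< h l<n)

  quasiConvex-⊔ : ∀ {n f g} → QuasiConvex n f → QuasiConvex n g → QuasiConvex n (λ i → f i ⊔ g i)
  quasiConvex-⊔ qf qg i≤j j≤l l<n =
    ⊔-lub (⊑-trans (qf i≤j j≤l l<n) (⊔-mono-≤ (x≤x⊔y _ _) (x≤x⊔y _ _)))
          (⊑-trans (qg i≤j j≤l l<n) (⊔-mono-≤ (x≤y⊔x _ _) (x≤y⊔x _ _)))

  module HalfCleaner {h} {b : ℕ → X} (qc : QuasiConvex (h + h) b) where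
    private
      between : ∀ {x i p l} → i ≤ p → p ≤ l → l < h + h → x ⊑ b p → x ⊑ b i ⊔ b l
      between i≤p p≤l l<2h x⊑bp = ⊑-trans x⊑bp (qc i≤p p≤l l<2h)

      <2h : ∀ {y} → y < h → y < h + h
      <2h y<h = <-≤-trans y<h (m≤m+n h h)

      +h<2h : ∀ {y} → y < h → y + h < h + h
      +h<2h = +-monoˡ-< h

      ≤+h : ∀ {x} y → x < h → x ≤ y + h
      ≤+h y x<h = ≤-trans (<⇒≤ x<h) (m≤n+m h y)

    maxHalf-quasiConvex : QuasiConvex h (maxHalf h b)
    maxHalf-quasiConvex = quasiConvex-⊔ (quasiConvex-≤ (m≤m+n h h) qc) (quasiConvex-shift h qc)

    minHalf⊑maxHalf : ∀ {x y} → x < h → y < h → minHalf h b y ⊑ maxHalf h b x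
    minHalf⊑maxHalf {x} {y} x<h y<h with y ≤? x
    ... | yes y≤x = between (≤+h y x<h) (+-monoˡ-≤ h y≤x) (+h<2h x<h) (x⊓y≤y _ _)
    ... | no  y≰x = between (<⇒≤ (≰⇒> y≰x)) (≤+h x y<h) (+h<2h x<h) (x⊓y≤x _ _)

    minHalf-alternationFree : AlternationFree h (minHalf h b)
    minHalf-alternationFree {p} {q} {r} {t} p≤q q≤r r≤t t<h = outer , inner
      where
      q<h : q < h
      q<h = ≤-<-trans q≤r (≤-<-trans r≤t t<h)
      r<h : r < h
      r<h = ≤-<-trans r≤t t<h
      into : ∀ {x u v i j} → u ≈ b i → v ≈ b j → x ⊑ b i ⊔ b j → x ⊑ u ⊔ v
      into u≈ v≈ = ⊑-respʳ-≈ (⊔-cong (Eq.sym u≈) (Eq.sym v≈))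
      outer : minHalf h b p ⊓ minHalf h b r ⊑ minHalf h b q ⊔ minHalf h b t
      outer with ⊓-sel (b q) (b (q + h)) | ⊓-sel (b t) (b (t + h))
      ... | inj₁ eq | inj₁ et =
        into eq et (between q≤r r≤t (<2h t<h) (⊑-trans (x⊓y≤y _ _) (x⊓y≤x _ _)))
      ... | inj₂ eq | inj₂ et =
        into eq et (between (+-monoˡ-≤ h q≤r) (+-monoˡ-≤ h r≤t) (+h<2h t<h) (⊑-trans (x⊓y≤y _ _) (x⊓y≤y _ _)))
      ... | inj₁ eq | inj₂ et =
        into eq et (between q≤r (≤+h t r<h) (+h<2h t<h) (⊑-trans (x⊓y≤y _ _) (x⊓y≤x _ _)))
      ... | inj₂ eq | inj₁ et =
        into eq et (⊑-respʳ-≈ (⊔-comm _ _)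
          (between (≤+h p t<h) (+-monoˡ-≤ h p≤q) (+h<2h q<h) (⊑-trans (x⊓y≤x _ _) (x⊓y≤y _ _))))
      inner : minHalf h b q ⊓ minHalf h b t ⊑ minHalf h b p ⊔ minHalf h b r
      inner with ⊓-sel (b p) (b (p + h)) | ⊓-sel (b r) (b (r + h))
      ... | inj₁ ep | inj₁ er =
        into ep er (between p≤q q≤r (<2h r<h) (⊑-trans (x⊓y≤x _ _) (x⊓y≤x _ _)))
      ... | inj₂ ep | inj₂ er =
        into ep er (between (+-monoˡ-≤ h p≤q) (+-monoˡ-≤ h q≤r) (+h<2h r<h) (⊑-trans (x⊓y≤x _ _) (x⊓y≤y _ _)))
      ... | inj₁ ep | inj₂ er =
        into ep er (between (≤-trans p≤q (≤-trans q≤r r≤t)) (≤+h r t<h) (+h<2h r<h)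
                            (⊑-trans (x⊓y≤y _ _) (x⊓y≤x _ _)))
      ... | inj₂ ep | inj₁ er =
        into ep er (⊑-respʳ-≈ (⊔-comm _ _)
          (between r≤t (≤+h p t<h) (+h<2h (≤-<-trans p≤q q<h)) (⊑-trans (x⊓y≤y _ _) (x⊓y≤x _ _))))

    module _ (md : MirrorDominating h b) where

      mirrorInterval⊑ : ∀ {i p} → i ≤ p → i + p < h + h → b p ⊑ b i
      mirrorInterval⊑ {i} {p} i≤p i+p<2h = ⊑-trans (qc i≤p p≤mirror mirror<2h) (⊔-lub ⊑-refl (md i<h))
        where
        i<h : i < h
        i<h = ≰⇒> (λ h≤i → <⇒≱ (≤-<-trans (+-monoʳ-≤ i i≤p) i+p<2h) (+-mono-≤ h≤i h≤i))
        p≤mirror : p ≤ h + h ∸ suc i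
        p≤mirror = m+n≤o⇒m≤o∸n p (subst (_≤ h + h) (+-comm (suc i) p) i+p<2h)
        mirror<2h : h + h ∸ suc i < h + h
        mirror<2h = ∸-monoʳ-< z<s (≤-trans (s≤s (m≤m+n i p)) i+p<2h)

      pair-sorted : ∀ {y} → y + y < h → b (y + h) ⊑ b y
      pair-sorted {y} 2y<h =
        mirrorInterval⊑ (m≤m+n y h) (subst (_< h + h) (+-assoc y y h) (+-monoˡ-< h 2y<h))

      maxHalf-mirrorDominating : ∀ {m} → m + m ≡ h → MirrorDominating m (maxHalf h b)
      maxHalf-mirrorDominating {m} m+m≡h {i} i<m =
        ⊑-trans (⊔-lub (mirrorInterval⊑ i≤j (<-≤-trans i+j<h (m≤m+n h h)))
                       (mirrorInterval⊑ (≤-trans i≤j (m≤m+n j h)) i+[j+h]<2h))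
                (x≤x⊔y _ _)
        where
        j : ℕ
        j = m + m ∸ suc i
        i≤j : i ≤ j
        i≤j = ≤-trans (<⇒≤ i<m) (subst (_≤ j) (m+n∸m≡n m m) (∸-monoʳ-≤ (m + m) i<m))
        i+j<h : i + j < h
        i+j<h = subst (suc (i + j) ≤_) m+m≡h
                  (≤-reflexive (m+[n∸m]≡n (≤-trans i<m (m≤m+n m m))))
        i+[j+h]<2h : i + (j + h) < h + h
        i+[j+h]<2h = subst (_< h + h) (+-assoc i j h) (+-monoˡ-< h i+j<h)

  module HalfSplit {k} (b : Fin k → X) (d : X) where
    private
      B W : ℕ → X
      B = extend d b
      W = extend d (halfSplit O b)

    halfSplit-firstQuarter : ∀ i → k / 4 ≤ k / 2 → toℕ i < k / 4 → halfSplit O b i ≡ B (toℕ i)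
    halfSplit-firstQuarter i q≤h i<q with k / 4 ≤? toℕ i | toℕ i <? k / 2 | 3 * (k / 4) ≤? toℕ i
    ... | yes q≤i | _ | _ = contradiction i<q (≤⇒≯ q≤i)
    ... | no _ | _ | no _ = sym (extend-toℕ d b i)
    ... | no _ | _ | yes _ with k / 2 ≤? toℕ i
    ...   | yes h≤i = contradiction (<-≤-trans i<q q≤h) (≤⇒≯ h≤i)
    ...   | no  _   = sym (extend-toℕ d b i)

    halfSplit-secondQuarter : ∀ i → k / 2 + k / 2 ≡ k → k / 4 ≤ toℕ i → toℕ i < k / 2 →
                              halfSplit O b i ≡ B (toℕ i) ⊔ B (toℕ i + k / 2)
    halfSplit-secondQuarter i hh q≤i i<h with k / 4 ≤? toℕ i | toℕ i <? k / 2 | 3 * (k / 4) ≤? toℕ i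
    ... | no q≰i | _ | _ = contradiction q≤i q≰i
    ... | yes _ | no i≮h | _ = contradiction i<h i≮h
    ... | yes _ | yes _ | _ with toℕ i + k / 2 <? k
    ...   | yes _     = cong (_⊔ _) (sym (extend-toℕ d b i))
    ...   | no  i+h≮k = contradiction (subst (toℕ i + k / 2 <_) hh (+-monoˡ-< (k / 2) i<h)) i+h≮k

    halfSplit-thirdQuarter : ∀ i → k / 2 ≤ toℕ i → toℕ i < 3 * (k / 4) → halfSplit O b i ≡ B (toℕ i)
    halfSplit-thirdQuarter i h≤i i<3q with k / 4 ≤? toℕ i | toℕ i <? k / 2 | 3 * (k / 4) ≤? toℕ i
    ... | _     | _       | yes 3q≤i = contradiction i<3q (≤⇒≯ 3q≤i)
    ... | _     | yes i<h | _        = contradiction i<h (≤⇒≯ h≤i)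
    ... | yes _ | no _    | no _     = sym (extend-toℕ d b i)
    ... | no _  | _       | no _     = sym (extend-toℕ d b i)

    private
      i∸h<k : ∀ i → toℕ i ∸ k / 2 < k
      i∸h<k i = ≤-<-trans (m∸n≤m (toℕ i) (k / 2)) (toℕ<n i)

    halfSplit-fourthQuarter : ∀ i → k / 2 ≤ toℕ i → 3 * (k / 4) ≤ toℕ i →
                              halfSplit O b i ≡ B (toℕ i ∸ k / 2) ⊓ B (toℕ i)
    halfSplit-fourthQuarter i h≤i 3q≤i with k / 4 ≤? toℕ i | toℕ i <? k / 2 | 3 * (k / 4) ≤? toℕ i
    ... | _     | _       | no 3q≰i = contradiction 3q≤i 3q≰i
    ... | _     | yes i<h | _       = contradiction i<h (≤⇒≯ h≤i)
    ... | yes _ | no _    | yes _ with k / 2 ≤? toℕ i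
    ...   | yes _   = cong₂ _⊓_ (sym (extend-fromℕ< d b (i∸h<k i))) (sym (extend-toℕ d b i))
    ...   | no  h≰i = contradiction h≤i h≰i
    -- halfSplit only reduces once its first test is known, hence this second copy.
    halfSplit-fourthQuarter i h≤i 3q≤i | no _ | _ | yes _ with k / 2 ≤? toℕ i
    ...   | yes _   = cong₂ _⊓_ (sym (extend-fromℕ< d b (i∸h<k i))) (sym (extend-toℕ d b i))
    ...   | no  h≰i = contradiction h≤i h≰i

    module _ (hh : k / 2 + k / 2 ≡ k) (hq : k / 4 + k / 4 ≡ k / 2)
             (qc : QuasiConvex k B) (md : MirrorDominating (k / 2) B) where
      open HalfCleaner {k / 2} (subst (λ n → QuasiConvex n B) (sym hh) qc)

      private
        h≤k : k / 2 ≤ k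
        h≤k = subst (k / 2 ≤_) hh (m≤m+n _ _)

        q≤h : k / 4 ≤ k / 2
        q≤h = subst (k / 4 ≤_) hq (m≤m+n _ _)

        3q≡h+q : 3 * (k / 4) ≡ k / 2 + k / 4
        3q≡h+q = trans (trans (cong (λ r → k / 4 + (k / 4 + r)) (+-identityʳ (k / 4)))
                              (sym (+-assoc (k / 4) (k / 4) (k / 4))))
                       (cong (_+ k / 4) hq)

        double< : ∀ {y} → y < k / 4 → y + y < k / 2
        double< {y} y<q = subst (y + y <_) hq (+-mono-< y<q y<q)

      halfSplit≈maxHalf : ∀ {x} → x < k / 2 → W x ≈ maxHalf (k / 2) B x
      halfSplit≈maxHalf x<h with toℕ-view (<-≤-trans x<h h≤k)
      ... | toℕ-of i = Eq.trans (Eq.reflexive (extend-toℕ d (halfSplit O b) i)) (cases (toℕ i <? k / 4))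
        where
        cases : Dec (toℕ i < k / 4) → halfSplit O b i ≈ maxHalf (k / 2) B (toℕ i)
        cases (yes i<q) = Eq.trans (Eq.reflexive (halfSplit-firstQuarter i q≤h i<q))
                                   (Eq.sym (x≥y⇒x⊔y≈x (pair-sorted md (double< i<q))))
        cases (no  i≮q) = Eq.reflexive (halfSplit-secondQuarter i hh (≮⇒≥ i≮q) x<h)

      halfSplit-secondHalf≈ : ∀ {z} → k / 2 ≤ z → z < k → W z ≈ B (z ∸ k / 2) ⊓ B z
      halfSplit-secondHalf≈ h≤z z<k with toℕ-view z<k
      ... | toℕ-of i = Eq.trans (Eq.reflexive (extend-toℕ d (halfSplit O b) i)) (cases (toℕ i <? 3 * (k / 4)))
        where
        cases : Dec (toℕ i < 3 * (k / 4)) → halfSplit O b i ≈ B (toℕ i ∸ k / 2) ⊓ B (toℕ i)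
        cases (yes i<3q) = Eq.trans (Eq.reflexive (halfSplit-thirdQuarter i h≤z i<3q))
                                    (Eq.sym (x≥y⇒x⊓y≈y sorted))
          where
          i∸h<q : toℕ i ∸ k / 2 < k / 4
          i∸h<q = <-≤-trans (∸-monoˡ-< (subst (toℕ i <_) 3q≡h+q i<3q) h≤z)
                            (≤-reflexive (m+n∸m≡n (k / 2) (k / 4)))
          sorted : B (toℕ i) ⊑ B (toℕ i ∸ k / 2)
          sorted = subst (λ z → B z ⊑ B (toℕ i ∸ k / 2)) (m∸n+n≡m h≤z) (pair-sorted md (double< i∸h<q))
        cases (no  i≮3q) = Eq.reflexive (halfSplit-fourthQuarter i h≤z (≮⇒≥ i≮3q))

      halfSplit≈minHalf : ∀ {y} → y < k / 2 → W (y + k / 2) ≈ minHalf (k / 2) B y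
      halfSplit≈minHalf {y} y<h =
        Eq.trans (halfSplit-secondHalf≈ (m≤n+m (k / 2) y) (subst (y + k / 2 <_) hh (+-monoˡ-< (k / 2) y<h)))
                 (Eq.reflexive (cong (λ x → B x ⊓ B (y + k / 2)) (m+n∸n≡m y (k / 2))))

      leftHalf≈[toℕ]maxHalf : leftHalf (halfSplit O b) ≈[toℕ] maxHalf (k / 2) B
      leftHalf≈[toℕ]maxHalf j =
        Eq.trans (Eq.reflexive (sym (extend-fromℕ< d (halfSplit O b) (<-≤-trans (toℕ<n j) h≤k))))
                 (halfSplit≈maxHalf (toℕ<n j))

      rightHalf≈[toℕ]minHalf : rightHalf (halfSplit O b) ≈[toℕ] minHalf (k / 2) B
      rightHalf≈[toℕ]minHalf j =
        Eq.trans (Eq.reflexive (trans (sym (extend-fromℕ< d (halfSplit O b) h+j<k))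
                                      (cong W (+-comm (k / 2) (toℕ j)))))
                 (halfSplit≈minHalf (toℕ<n j))
        where
        h+j<k : k / 2 + toℕ j < k
        h+j<k = subst (k / 2 + toℕ j <_) hh (+-monoʳ-< (k / 2) (toℕ<n j))

  vShapeSDominating-halfSplit : ∀ {k} (b : Fin k → X) → k / 2 + k / 2 ≡ k → k / 4 + k / 4 ≡ k / 2 →
    0 < k / 2 → VShapeSDominating O b →
    VShapeSDominating O (leftHalf (halfSplit O b)) × Bitonic O (rightHalf (halfSplit O b)) ×
    _⪰_ O (leftHalf (halfSplit O b)) (rightHalf (halfSplit O b))
  vShapeSDominating-halfSplit {k} b hh hq 0<h (vb , sb) =
    (quasiConvex⇒vShaped L≈ maxHalf-quasiConvex z ,
     mirrorDominating⇒sDominating L≈ h/2+h/2≡h (maxHalf-mirrorDominating md h/2+h/2≡h)) ,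
    alternationFree⇒bitonic R≈ minHalf-alternationFree z ,
    λ i j → ⊑-resp-≈ (Eq.sym (R≈ j)) (Eq.sym (L≈ i)) (minHalf⊑maxHalf (toℕ<n i) (toℕ<n j))
    where
    z : Fin (k / 2)
    z = fromℕ< 0<h
    d : X
    d = b (fromℕ< (<-≤-trans 0<h (subst (k / 2 ≤_) hh (m≤m+n _ _))))
    qc : QuasiConvex k (extend d b)
    qc = vShaped⇒quasiConvex d vb
    md : MirrorDominating (k / 2) (extend d b)
    md = sDominating⇒mirrorDominating d hh sb
    L≈ : leftHalf (halfSplit O b) ≈[toℕ] maxHalf (k / 2) (extend d b)
    L≈ = HalfSplit.leftHalf≈[toℕ]maxHalf b d hh hq qc md
    R≈ : rightHalf (halfSplit O b) ≈[toℕ] minHalf (k / 2) (extend d b)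
    R≈ = HalfSplit.rightHalf≈[toℕ]minHalf b d hh hq qc md
    open HalfCleaner {k / 2} (subst (λ n → QuasiConvex n (extend d b)) (sym hh) qc)
    h/2+h/2≡h : k / 2 / 2 + k / 2 / 2 ≡ k / 2
    h/2+h/2≡h = trans (cong (λ m → m + m) (trans (cong (_/ 2) (sym hq)) ([m+m]/2≡m (k / 4)))) hq

mainTheorem8 : ∀ {c ℓ₁ ℓ₂ : Level} (O : TotalOrder c ℓ₁ ℓ₂) (k : ℕ) →
    (∃ λ (p : ℕ) → k ≡ 2 ^ p) → 4 ≤ k →
    (b : Fin k → TotalOrder.Carrier O) →
    VShapeSDominating O b →
    VShapeSDominating O (leftHalf (halfSplit O b)) ×
    Bitonic O (rightHalf (halfSplit O b)) ×
    _⪰_ O (leftHalf (halfSplit O b)) (rightHalf (halfSplit O b))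
mainTheorem8 O k (p , refl) 4≤k b with 4∣⇒exact-halving (4≤2^p⇒4∣2^p p 4≤k)
... | hh , hq = vShapeSDominating-halfSplit O b hh hq (m≥n⇒m/n>0 (≤-trans (s≤s (s≤s z≤n)) 4≤k))
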